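{- $\mathsf{BS}$ is Weihrauch equivalent to its restriction to partial orders.
   Context: Quasi-orders and partial orders on subsets of $\mathbb{N}$ are given by the characteristic function of $\{\langle n,m\rangle: n\preceq m\}$. A sequence $(q_i)$ is bad if $q_i\not\preceq q_j$ for all $i<j$; a well quasi-order has no infinite bad sequence. $\mathsf{BS}$: given a countable quasi-order that is not a well quasi-order, output an infinite bad sequence. Weihrauch equivalence is mutual Weihrauch reducibility. -}

module Defs where

open import Data.Nat using (ℕ; zero; suc; _+_; _<_; _≤_)
open import Data.Fin using (Fin)
open import Data.Vec using (Vec; []; _∷_; lookup)
open import Data.Product using (Σ; _×_; ∃)
open import Relation.Binary.PropositionalEquality using (_≡_)
open import Relation.Nullary using (¬_)

-- Oracle computability: Kleene μ-recursive functions relative to an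
-- oracle α : ℕ → ℕ (a standard Turing-complete model of type-2
-- computability on Baire space).

data Code : ℕ → Set where
  zer  : ∀ {n} → Code n
  succ : Code 1
  proj : ∀ {n} → Fin n → Code n
  orc  : Code 1
  comp : ∀ {n m} → Code m → Vec (Code n) m → Code n
  prec : ∀ {n} → Code n → Code (suc (suc n)) → Code (suc n)
  mu   : ∀ {n} → Code (suc n) → Code n

mutual
  data Eval (α : ℕ → ℕ) : ∀ {n} → Code n → Vec ℕ n → ℕ → Set where
    ev-zer  : ∀ {n} {xs : Vec ℕ n} → Eval α zer xs 0
    ev-succ : ∀ {x} → Eval α succ (x ∷ []) (suc x)
    ev-proj : ∀ {n} {i : Fin n} {xs} → Eval α (proj i) xs (lookup xs i)
    ev-orc  : ∀ {x} → Eval α orc (x ∷ []) (α x)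
    ev-comp : ∀ {n m} {f : Code m} {gs : Vec (Code n) m} {xs ys r} →
              EvalVec α gs xs ys → Eval α f ys r → Eval α (comp f gs) xs r
    ev-prec0 : ∀ {n} {f : Code n} {g} {xs r} →
               Eval α f xs r → Eval α (prec f g) (0 ∷ xs) r
    ev-precS : ∀ {n} {f : Code n} {g} {xs y r s} →
               Eval α (prec f g) (y ∷ xs) r → Eval α g (y ∷ r ∷ xs) s →
               Eval α (prec f g) (suc y ∷ xs) s
    ev-mu : ∀ {n} {f : Code (suc n)} {xs y} →
            Eval α f (y ∷ xs) 0 →
            (∀ z → z < y → Σ ℕ (λ k → Eval α f (z ∷ xs) (suc k))) →
            Eval α (mu f) xs y

  data EvalVec (α : ℕ → ℕ) {n : ℕ} : ∀ {m} → Vec (Code n) m → Vec ℕ n → Vec ℕ m → Set where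
    []  : ∀ {xs} → EvalVec α [] xs []
    _∷_ : ∀ {m} {g} {gs : Vec (Code n) m} {xs y ys} →
          Eval α g xs y → EvalVec α gs xs ys → EvalVec α (g ∷ gs) xs (y ∷ ys)

Computes : (ℕ → ℕ) → Code 1 → (ℕ → ℕ) → Set
Computes α e f = ∀ x → Eval α e (x ∷ []) (f x)

-- join of two elements of Baire space: (p ⊕ q)(2n) = p n, (p ⊕ q)(2n+1) = q n
join : (ℕ → ℕ) → (ℕ → ℕ) → ℕ → ℕ
join p q zero = p 0
join p q (suc zero) = q 0
join p q (suc (suc n)) = join (λ k → p (suc k)) (λ k → q (suc k)) n

record Problem : Set₁ where
  field
    dom : (ℕ → ℕ) → Set
    sol : (ℕ → ℕ) → (ℕ → ℕ) → Set
open Problem public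

_≤W_ : Problem → Problem → Set
P ≤W Q = Σ (Code 1) λ Φ → Σ (Code 1) λ Ψ →
  ∀ p → dom P p →
    Σ (ℕ → ℕ) λ φp → Computes p Φ φp × dom Q φp ×
      (∀ q → sol Q φp q →
         Σ (ℕ → ℕ) λ ψ → Computes (join p q) Ψ ψ × sol P p ψ)

_≡W_ : Problem → Problem → Set
P ≡W Q = (P ≤W Q) × (Q ≤W P)

-- Quasi-orders on subsets of ℕ, via characteristic functions of
-- { ⟨n,m⟩ : n ≼ m } with Cantor pairing.

tri : ℕ → ℕ
tri zero = zero
tri (suc k) = suc k + tri k

⟨_,_⟩ : ℕ → ℕ → ℕ
⟨ n , m ⟩ = tri (n + m) + m

_⊢_≼_ : (ℕ → ℕ) → ℕ → ℕ → Set
R ⊢ n ≼ m = R ⟨ n , m ⟩ ≡ 1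

InField : (ℕ → ℕ) → ℕ → Set
InField R n = R ⊢ n ≼ n

record IsQuasiOrder (R : ℕ → ℕ) : Set where
  field
    charFun : ∀ k → R k ≤ 1
    left    : ∀ {n m} → R ⊢ n ≼ m → InField R n
    right   : ∀ {n m} → R ⊢ n ≼ m → InField R m
    trans   : ∀ {n m k} → R ⊢ n ≼ m → R ⊢ m ≼ k → R ⊢ n ≼ k

record IsPartialOrder (R : ℕ → ℕ) : Set where
  field
    isQuasiOrder : IsQuasiOrder R
    antisym      : ∀ {n m} → R ⊢ n ≼ m → R ⊢ m ≼ n → n ≡ m

Bad : (ℕ → ℕ) → (ℕ → ℕ) → Set
Bad R q = (∀ i → InField R (q i)) × (∀ i j → i < j → ¬ (R ⊢ q i ≼ q j))

IsWQO : (ℕ → ℕ) → Set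
IsWQO R = ∀ q → ¬ Bad R q

BS : Problem
BS = record { dom = λ R → IsQuasiOrder R × ¬ IsWQO R ; sol = Bad }

BS-PO : Problem
BS-PO = record { dom = λ R → IsPartialOrder R × ¬ IsWQO R ; sol = Bad }

-- A quasi-order R is turned into a partial order by restricting it to the least
-- element of each equivalence class {k : k ≼ n ≼ k}. Whether n is least in its
-- class only involves the finitely many k < n, so the restriction is computable
-- uniformly in R. A bad sequence of the restriction is bad for R, and a bad
-- sequence of R becomes one of the restriction after replacing each term by the
-- representative of its class; so BS reduces to BS on partial orders, and the
-- converse reduction is the identity.
module Submission where

open import Defs
open import Data.Nat
  using (ℕ; zero; suc; _+_; _*_; _∸_; _<_; _≤_; z≤n; s≤s; s≤s⁻¹; z<s; pred; _≟_)
open import Data.Nat.Properties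
open import Data.Nat.Induction using (<-rec)
open import Data.Fin using (Fin; #_)
open import Data.Vec using (Vec; []; _∷_; lookup)
open import Data.Vec.N-ary using (_$ⁿ_)
open import Data.Product using (Σ; ∃; _×_; _,_; proj₁; proj₂)
open import Data.Sum using (inj₁; inj₂)
open import Function using (_∘_; flip)
open import Relation.Nullary using (¬_; yes; no; contradiction)
open import Relation.Binary using (tri<; tri≈; tri>)
open import Relation.Binary.PropositionalEquality
  using (_≡_; _≢_; refl; sym; trans; cong; cong₂; subst)

Implements : (ℕ → ℕ) → ∀ {n} → Code n → (Vec ℕ n → ℕ) → Set
Implements α c F = ∀ xs → Eval α c xs (F xs)

Implements⇒Computes : ∀ {α e f} → Implements α e (f $ⁿ_) → Computes α e f
Implements⇒Computes e⊨f x = e⊨f (x ∷ [])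

Implements-ext : ∀ {α n} {c : Code n} {F G} →
                 Implements α c F → (∀ xs → F xs ≡ G xs) → Implements α c G
Implements-ext {α} {c = c} c⊨F F≗G xs = subst (Eval α c xs) (F≗G xs) (c⊨F xs)

compose₁ : ∀ {n} → Code 1 → Code n → Code n
compose₁ f g = comp f (g ∷ [])

compose₂ : ∀ {n} → Code 2 → Code n → Code n → Code n
compose₂ f g h = comp f (g ∷ h ∷ [])

module _ {α : ℕ → ℕ} where

  zer-implements : ∀ {n} → Implements α (zer {n}) (λ _ → 0)
  zer-implements _ = ev-zer

  succ-implements : Implements α succ (suc $ⁿ_)
  succ-implements (_ ∷ []) = ev-succ

  proj-implements : ∀ {n} (i : Fin n) → Implements α (proj i) (flip lookup i)
  proj-implements _ _ = ev-proj

  orc-implements : Implements α orc (α $ⁿ_)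
  orc-implements (_ ∷ []) = ev-orc

  compose₁-implements : ∀ {n} {f : Code 1} {g : Code n} {F G} →
    Implements α f F → Implements α g G →
    Implements α (compose₁ f g) (λ xs → F (G xs ∷ []))
  compose₁-implements f⊨F g⊨G xs = ev-comp (g⊨G xs ∷ []) (f⊨F _)

  compose₂-implements : ∀ {n} {f : Code 2} {g h : Code n} {F G H} →
    Implements α f F → Implements α g G → Implements α h H →
    Implements α (compose₂ f g h) (λ xs → F (G xs ∷ H xs ∷ []))
  compose₂-implements f⊨F g⊨G h⊨H xs = ev-comp (g⊨G xs ∷ h⊨H xs ∷ []) (f⊨F _)

  prec-implements : ∀ {n} {f : Code n} {g : Code (suc (suc n))} {F G}
    (H : Vec ℕ (suc n) → ℕ) → Implements α f F → Implements α g G →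
    (∀ xs → H (0 ∷ xs) ≡ F xs) →
    (∀ y xs → H (suc y ∷ xs) ≡ G (y ∷ H (y ∷ xs) ∷ xs)) →
    Implements α (prec f g) H
  prec-implements {f = f} {g} H f⊨F g⊨G H-zero H-suc (y ∷ xs) = go y
    where
    go : ∀ y → Eval α (prec f g) (y ∷ xs) (H (y ∷ xs))
    go zero    = subst (Eval α _ _) (sym (H-zero xs)) (ev-prec0 (f⊨F xs))
    go (suc y) = subst (Eval α _ _) (sym (H-suc y xs)) (ev-precS (go y) (g⊨G _))

  mu-evaluates-to-least-zero : ∀ {n} {f : Code (suc n)} {F} → Implements α f F →
    ∀ xs y → F (y ∷ xs) ≡ 0 → (∀ z → z < y → F (z ∷ xs) ≢ 0) → Eval α (mu f) xs y
  mu-evaluates-to-least-zero {f = f} {F} f⊨F xs y Fy≡0 Fz≢0 =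
    ev-mu (subst (Eval α f (y ∷ xs)) Fy≡0 (f⊨F _)) positive-below
    where
    positive-below : ∀ z → z < y → Σ ℕ λ k → Eval α f (z ∷ xs) (suc k)
    positive-below z z<y with F (z ∷ xs) in eq
    ... | zero  = contradiction eq (Fz≢0 z z<y)
    ... | suc k = k , subst (Eval α f (z ∷ xs)) eq (f⊨F _)

addCode : Code 2
addCode = prec (proj (# 0)) (compose₁ succ (proj (# 1)))

predCode : Code 1
predCode = prec zer (proj (# 0))

-- arguments are swapped: the recursion runs on the subtrahend
monusCode : Code 2
monusCode = prec (proj (# 0)) (compose₁ predCode (proj (# 1)))

mulCode : Code 2
mulCode = prec zer (compose₂ addCode (proj (# 2)) (proj (# 1)))

triCode : Code 1
triCode = prec zer (compose₂ addCode (compose₁ succ (proj (# 0))) (proj (# 1)))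

pairCode : Code 2
pairCode =
  compose₂ addCode (compose₁ triCode (compose₂ addCode (proj (# 0)) (proj (# 1)))) (proj (# 1))

module _ {α : ℕ → ℕ} where

  addCode-implements : Implements α addCode (_+_ $ⁿ_)
  addCode-implements =
    prec-implements _ (proj-implements (# 0))
      (compose₁-implements succ-implements (proj-implements (# 1)))
      (λ { (_ ∷ []) → refl }) (λ { _ (_ ∷ []) → refl })

  predCode-implements : Implements α predCode (pred $ⁿ_)
  predCode-implements = prec-implements _ zer-implements (proj-implements (# 0))
    (λ { [] → refl }) (λ { _ [] → refl })

  monusCode-implements : Implements α monusCode (flip _∸_ $ⁿ_)
  monusCode-implements =
    prec-implements _ (proj-implements (# 0))
      (compose₁-implements predCode-implements (proj-implements (# 1)))
      (λ { (_ ∷ []) → refl }) (λ { y (x ∷ []) → sym (pred[m∸n]≡m∸[1+n] x y) })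

  mulCode-implements : Implements α mulCode (_*_ $ⁿ_)
  mulCode-implements =
    prec-implements _ zer-implements
      (compose₂-implements addCode-implements (proj-implements (# 2)) (proj-implements (# 1)))
      (λ { (_ ∷ []) → refl }) (λ { _ (_ ∷ []) → refl })

  triCode-implements : Implements α triCode (tri $ⁿ_)
  triCode-implements =
    prec-implements _ zer-implements
      (compose₂-implements addCode-implements
        (compose₁-implements succ-implements (proj-implements (# 0))) (proj-implements (# 1)))
      (λ { [] → refl }) (λ { _ [] → refl })

  pairCode-implements : Implements α pairCode (⟨_,_⟩ $ⁿ_)
  pairCode-implements = Implements-ext
    (compose₂-implements addCode-implements
      (compose₁-implements triCode-implements
        (compose₂-implements addCode-implements (proj-implements (# 0)) (proj-implements (# 1))))
      (proj-implements (# 1)))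
    (λ { (_ ∷ _ ∷ []) → refl })

tri-mono-≤ : ∀ {a b} → a ≤ b → tri a ≤ tri b
tri-mono-≤ {zero}  _         = z≤n
tri-mono-≤ {suc a} (s≤s a≤b) = +-mono-≤ (s≤s a≤b) (tri-mono-≤ a≤b)

record Diagonal (x : ℕ) : Set where
  constructor diagonal
  field
    index : ℕ
    lower : tri index ≤ x
    upper : x < tri (suc index)

diagonal-unique : ∀ {x} (d e : Diagonal x) → Diagonal.index d ≡ Diagonal.index e
diagonal-unique (diagonal d d≤ <d) (diagonal e e≤ <e) with <-cmp d e
... | tri< d<e _ _ = contradiction (≤-trans (tri-mono-≤ d<e) e≤) (<⇒≱ <d)
... | tri≈ _ d≡e _ = d≡e
... | tri> _ _ e<d = contradiction (≤-trans (tri-mono-≤ e<d) d≤) (<⇒≱ <e)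

diagonalOf : ∀ x → Diagonal x
diagonalOf zero    = diagonal 0 z≤n (s≤s z≤n)
diagonalOf (suc x) with diagonalOf x
... | diagonal d d≤ <d with m≤n⇒m<n∨m≡n <d
...   | inj₁ 1+x<end = diagonal d (m≤n⇒m≤1+n d≤) 1+x<end
...   | inj₂ 1+x≡end =
  diagonal (suc d) (≤-reflexive (sym 1+x≡end))
           (subst (_< tri (suc (suc d))) (sym 1+x≡end) (m<n+m (tri (suc d)) {suc (suc d)} z<s))

diagonal-pair : ∀ n m → Diagonal ⟨ n , m ⟩
diagonal-pair n m =
  diagonal (n + m) (m≤m+n (tri (n + m)) m)
    (subst (⟨ n , m ⟩ <_) (+-comm (tri (n + m)) (suc (n + m)))
           (+-monoʳ-< (tri (n + m)) (s≤s (m≤n+m m n))))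

diag : ℕ → ℕ
diag x = Diagonal.index (diagonalOf x)

unpair₂ unpair₁ : ℕ → ℕ
unpair₂ x = x ∸ tri (diag x)
unpair₁ x = diag x ∸ unpair₂ x

diag-pair : ∀ n m → diag ⟨ n , m ⟩ ≡ n + m
diag-pair n m = diagonal-unique (diagonalOf ⟨ n , m ⟩) (diagonal-pair n m)

unpair₂-pair : ∀ n m → unpair₂ ⟨ n , m ⟩ ≡ m
unpair₂-pair n m rewrite diag-pair n m = m+n∸m≡n (tri (n + m)) m

unpair₁-pair : ∀ n m → unpair₁ ⟨ n , m ⟩ ≡ n
unpair₁-pair n m rewrite unpair₂-pair n m | diag-pair n m = m+n∸n≡m n m

-- least z with x < tri (suc z)
diagCode : Code 1
diagCode = mu (compose₂ monusCode (compose₁ triCode (compose₁ succ (proj (# 0))))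
                                  (compose₁ succ (proj (# 1))))

unpair₂Code unpair₁Code : Code 1
unpair₂Code = compose₂ monusCode (compose₁ triCode diagCode) (proj (# 0))
unpair₁Code = compose₂ monusCode unpair₂Code diagCode

module _ {α : ℕ → ℕ} where

  diagCode-implements : Implements α diagCode (diag $ⁿ_)
  diagCode-implements (x ∷ []) with diagonalOf x
  ... | diagonal d d≤ <d =
    mu-evaluates-to-least-zero
      (compose₂-implements monusCode-implements
        (compose₁-implements triCode-implements
          (compose₁-implements succ-implements (proj-implements (# 0))))
        (compose₁-implements succ-implements (proj-implements (# 1))))
      (x ∷ []) d (m≤n⇒m∸n≡0 <d)
      (λ z z<d eq → <⇒≱ (s≤s (≤-trans (tri-mono-≤ z<d) d≤)) (m∸n≡0⇒m≤n eq))

  unpair₂Code-implements : Implements α unpair₂Code (unpair₂ $ⁿ_)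
  unpair₂Code-implements = Implements-ext
    (compose₂-implements monusCode-implements
      (compose₁-implements triCode-implements diagCode-implements) (proj-implements (# 0)))
    (λ { (_ ∷ []) → refl })

  unpair₁Code-implements : Implements α unpair₁Code (unpair₁ $ⁿ_)
  unpair₁Code-implements = Implements-ext
    (compose₂-implements monusCode-implements unpair₂Code-implements diagCode-implements)
    (λ { (_ ∷ []) → refl })

sumBelow : (ℕ → ℕ) → ℕ → ℕ
sumBelow f zero    = 0
sumBelow f (suc i) = sumBelow f i + f i

sumBelow≡0⇒≡0 : ∀ f {i k} → sumBelow f i ≡ 0 → k < i → f k ≡ 0
sumBelow≡0⇒≡0 f {suc i} sum≡0 k<1+i with m≤n⇒m<n∨m≡n (s≤s⁻¹ k<1+i)
... | inj₁ k<i  = sumBelow≡0⇒≡0 f (m+n≡0⇒m≡0 _ sum≡0) k<i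
... | inj₂ refl = m+n≡0⇒n≡0 (sumBelow f i) sum≡0

sumBelow≢0⇒∃≢0 : ∀ f {i} → sumBelow f i ≢ 0 → ∃ λ k → k < i × f k ≢ 0
sumBelow≢0⇒∃≢0 f {zero}  sum≢0 = contradiction refl sum≢0
sumBelow≢0⇒∃≢0 f {suc i} sum≢0 with f i ≟ 0
... | no  fi≢0 = i , ≤-refl , fi≢0
... | yes fi≡0 with sumBelow≢0⇒∃≢0 f (λ sum≡0 → sum≢0 (cong₂ _+_ sum≡0 fi≡0))
...   | k , k<i , fk≢0 = k , m<n⇒m<1+n k<i , fk≢0

1∸n≡1⇒n≡0 : ∀ {n} → 1 ∸ n ≡ 1 → n ≡ 0
1∸n≡1⇒n≡0 {zero}  _  = refl
1∸n≡1⇒n≡0 {suc n} eq = contradiction (trans (sym (0∸n≡0 n)) eq) λ ()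

bit*bit≢0⇒≡1 : ∀ {a b} → a ≤ 1 → b ≤ 1 → a * b ≢ 0 → a ≡ 1 × b ≡ 1
bit*bit≢0⇒≡1 z≤n       _         ab≢0 = contradiction refl ab≢0
bit*bit≢0⇒≡1 (s≤s z≤n) z≤n       ab≢0 = contradiction refl ab≢0
bit*bit≢0⇒≡1 (s≤s z≤n) (s≤s z≤n) _    = refl , refl

_⊢_≈_ : (ℕ → ℕ) → ℕ → ℕ → Set
R ⊢ k ≈ n = R ⊢ k ≼ n × R ⊢ n ≼ k

-- for bits this is 1 exactly when k and n are equivalent
equivBit : (ℕ → ℕ) → ℕ → ℕ → ℕ
equivBit R n k = R ⟨ k , n ⟩ * R ⟨ n , k ⟩

leastBit : (ℕ → ℕ) → ℕ → ℕ
leastBit R n = 1 ∸ sumBelow (equivBit R n) n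

LeastInClass : (ℕ → ℕ) → ℕ → Set
LeastInClass R n = leastBit R n ≡ 1

restrict : (ℕ → ℕ) → ℕ → ℕ
restrict R x = leastBit R (unpair₁ x) * (leastBit R (unpair₂ x) * R x)

equivBitCode : Code 2
equivBitCode = compose₂ mulCode (compose₁ orc (compose₂ pairCode (proj (# 1)) (proj (# 0))))
                                (compose₁ orc (compose₂ pairCode (proj (# 0)) (proj (# 1))))

equivCountCode : Code 2
equivCountCode =
  prec zer (compose₂ addCode (proj (# 1)) (compose₂ equivBitCode (proj (# 2)) (proj (# 0))))

leastBitCode : Code 1
leastBitCode =
  compose₂ monusCode (compose₂ equivCountCode (proj (# 0)) (proj (# 0))) (compose₁ succ zer)

restrictCode : Code 1
restrictCode = compose₂ mulCode (compose₁ leastBitCode unpair₁Code)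
                                (compose₂ mulCode (compose₁ leastBitCode unpair₂Code) orc)

module _ {α : ℕ → ℕ} where

  equivBitCode-implements : Implements α equivBitCode (equivBit α $ⁿ_)
  equivBitCode-implements = Implements-ext
    (compose₂-implements mulCode-implements
      (compose₁-implements orc-implements
        (compose₂-implements pairCode-implements (proj-implements (# 1)) (proj-implements (# 0))))
      (compose₁-implements orc-implements
        (compose₂-implements pairCode-implements (proj-implements (# 0)) (proj-implements (# 1)))))
    (λ { (_ ∷ _ ∷ []) → refl })

  equivCountCode-implements :
    Implements α equivCountCode (λ { (i ∷ n ∷ []) → sumBelow (equivBit α n) i })
  equivCountCode-implements =
    prec-implements _ zer-implements
      (compose₂-implements addCode-implements (proj-implements (# 1))
        (compose₂-implements equivBitCode-implements (proj-implements (# 2)) (proj-implements (# 0))))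
      (λ { (_ ∷ []) → refl }) (λ { _ (_ ∷ []) → refl })

  leastBitCode-implements : Implements α leastBitCode (leastBit α $ⁿ_)
  leastBitCode-implements = Implements-ext
    (compose₂-implements monusCode-implements
      (compose₂-implements equivCountCode-implements (proj-implements (# 0)) (proj-implements (# 0)))
      (compose₁-implements succ-implements zer-implements))
    (λ { (_ ∷ []) → refl })

  restrictCode-implements : Implements α restrictCode (restrict α $ⁿ_)
  restrictCode-implements = Implements-ext
    (compose₂-implements mulCode-implements
      (compose₁-implements leastBitCode-implements unpair₁Code-implements)
      (compose₂-implements mulCode-implements
        (compose₁-implements leastBitCode-implements unpair₂Code-implements) orc-implements))
    (λ { (_ ∷ []) → refl })

module _ {R : ℕ → ℕ} where

  leastBit≤1 : ∀ n → leastBit R n ≤ 1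
  leastBit≤1 n = m∸n≤m 1 (sumBelow (equivBit R n) n)

  LeastInClass⇒¬≈-below : ∀ {n k} → LeastInClass R n → k < n → ¬ (R ⊢ k ≈ n)
  LeastInClass⇒¬≈-below {n} least k<n (k≼n , n≼k) = contradiction 1≡0 λ ()
    where
    1≡0 : 1 * 1 ≡ 0
    1≡0 = trans (sym (cong₂ _*_ k≼n n≼k)) (sumBelow≡0⇒≡0 (equivBit R n) (1∸n≡1⇒n≡0 least) k<n)

  ¬LeastInClass⇒≈-below : (∀ x → R x ≤ 1) → ∀ n → ¬ LeastInClass R n →
                          ∃ λ k → k < n × R ⊢ k ≈ n
  ¬LeastInClass⇒≈-below bits n ¬least
    with sumBelow≢0⇒∃≢0 (equivBit R n) (λ sum≡0 → ¬least (cong (1 ∸_) sum≡0))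
  ... | k , k<n , bit≢0 = k , k<n , bit*bit≢0⇒≡1 (bits _) (bits _) bit≢0

  restrict-pair : ∀ n m → restrict R ⟨ n , m ⟩ ≡ leastBit R n * (leastBit R m * R ⟨ n , m ⟩)
  restrict-pair n m = cong₂ (λ a b → leastBit R a * (leastBit R b * R ⟨ n , m ⟩))
                            (unpair₁-pair n m) (unpair₂-pair n m)

  restrict-≼⁻ : ∀ n m → restrict R ⊢ n ≼ m →
                LeastInClass R n × LeastInClass R m × R ⊢ n ≼ m
  restrict-≼⁻ n m n≼m =
    m*n≡1⇒m≡1 (leastBit R n) _ product≡1 ,
    m*n≡1⇒m≡1 (leastBit R m) _ rest≡1 ,
    m*n≡1⇒n≡1 (leastBit R m) _ rest≡1
    where
    product≡1 : leastBit R n * (leastBit R m * R ⟨ n , m ⟩) ≡ 1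
    product≡1 = trans (sym (restrict-pair n m)) n≼m
    rest≡1 : leastBit R m * R ⟨ n , m ⟩ ≡ 1
    rest≡1 = m*n≡1⇒n≡1 (leastBit R n) _ product≡1

  restrict-≼⁺ : ∀ n m → LeastInClass R n → LeastInClass R m → R ⊢ n ≼ m →
                restrict R ⊢ n ≼ m
  restrict-≼⁺ n m least-n least-m n≼m rewrite restrict-pair n m | least-n | least-m | n≼m = refl

  restrict-bad⇒bad : ∀ q → Bad (restrict R) q → Bad R q
  restrict-bad⇒bad q (in-field , bad) = proj₂ ∘ proj₂ ∘ least-in-field , R-bad
    where
    least-in-field : ∀ i → LeastInClass R (q i) × LeastInClass R (q i) × InField R (q i)
    least-in-field i = restrict-≼⁻ (q i) (q i) (in-field i)

    R-bad : ∀ i j → i < j → ¬ (R ⊢ q i ≼ q j)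
    R-bad i j i<j qi≼qj = bad i j i<j
      (restrict-≼⁺ (q i) (q j) (proj₁ (least-in-field i)) (proj₁ (least-in-field j)) qi≼qj)

  module _ (qo : IsQuasiOrder R) where
    open IsQuasiOrder qo renaming (trans to ≼-trans)

    restrict-isPartialOrder : IsPartialOrder (restrict R)
    restrict-isPartialOrder = record
      { isQuasiOrder = record
        { charFun = λ x → *-mono-≤ (leastBit≤1 (unpair₁ x))
                                    (*-mono-≤ (leastBit≤1 (unpair₂ x)) (charFun x))
        ; left    = λ {n} {m} n≼m → let (least-n , _ , n≼m) = restrict-≼⁻ n m n≼m
                                  in restrict-≼⁺ n n least-n least-n (left {n} {m} n≼m)
        ; right   = λ {n} {m} n≼m → let (_ , least-m , n≼m) = restrict-≼⁻ n m n≼m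
                                  in restrict-≼⁺ m m least-m least-m (right {n} {m} n≼m)
        ; trans   = λ {n} {m} {k} n≼m m≼k →
                      let (least-n , _ , n≼m) = restrict-≼⁻ n m n≼m
                          (_ , least-k , m≼k) = restrict-≼⁻ m k m≼k
                      in restrict-≼⁺ n k least-n least-k (≼-trans {n} {m} {k} n≼m m≼k)
        }
      ; antisym = λ {n} {m} n≼m m≼n → antisym (restrict-≼⁻ n m n≼m) (restrict-≼⁻ m n m≼n)
      }
      where
      antisym : ∀ {n m} → LeastInClass R n × LeastInClass R m × R ⊢ n ≼ m →
                LeastInClass R m × LeastInClass R n × R ⊢ m ≼ n → n ≡ m
      antisym {n} {m} (least-n , least-m , n≼m) (_ , _ , m≼n) with <-cmp n m
      ... | tri< n<m _ _ = contradiction (n≼m , m≼n) (LeastInClass⇒¬≈-below least-m n<m)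
      ... | tri≈ _ n≡m _ = n≡m
      ... | tri> _ _ m<n = contradiction (m≼n , n≼m) (LeastInClass⇒¬≈-below least-n m<n)

    record Representative (n : ℕ) : Set where
      field
        element    : ℕ
        element≼n  : R ⊢ element ≼ n
        n≼element  : R ⊢ n ≼ element
        least      : LeastInClass R element

    representative : ∀ n → InField R n → Representative n
    representative = <-rec (λ n → InField R n → Representative n) descend
      where
      descend : ∀ n → (∀ {k} → k < n → InField R k → Representative k) →
                InField R n → Representative n
      descend n rec n∈R with leastBit R n ≟ 1
      ... | yes least = record { element = n ; element≼n = n∈R ; n≼element = n∈R ; least = least }
      ... | no ¬least with ¬LeastInClass⇒≈-below charFun n ¬least
      ...   | k , k<n , (k≼n , n≼k) with rec k<n (left {k} {n} k≼n)
      ...     | record { element = r ; element≼n = r≼k ; n≼element = k≼r ; least = least } =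
        record { element   = r
               ; element≼n = ≼-trans {r} {k} {n} r≼k k≼n
               ; n≼element = ≼-trans {n} {k} {r} n≼k k≼r
               ; least     = least
               }

    bad⇒restrict-bad : ∀ q → Bad R q → Σ (ℕ → ℕ) (Bad (restrict R))
    bad⇒restrict-bad q (in-field , bad) = r , r-in-field , r-bad
      where
      open Representative

      rep : ∀ i → Representative (q i)
      rep i = representative (q i) (in-field i)

      r : ℕ → ℕ
      r i = element (rep i)

      r-in-field : ∀ i → InField (restrict R) (r i)
      r-in-field i = restrict-≼⁺ (r i) (r i) (least (rep i)) (least (rep i))
                                 (left {r i} {q i} (element≼n (rep i)))

      r-bad : ∀ i j → i < j → ¬ (restrict R ⊢ r i ≼ r j)
      r-bad i j i<j ri≼rj = bad i j i<j
        (≼-trans {q i} {r i} {q j} (n≼element (rep i))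
          (≼-trans {r i} {r j} {q j} ri≼rj-in-R (element≼n (rep j))))
        where
        ri≼rj-in-R : R ⊢ r i ≼ r j
        ri≼rj-in-R = proj₂ (proj₂ (restrict-≼⁻ (r i) (r j) ri≼rj))

    restrict-¬wqo : ¬ IsWQO R → ¬ IsWQO (restrict R)
    restrict-¬wqo ¬wqo wqo =
      ¬wqo λ q bad → let (q′ , bad′) = bad⇒restrict-bad q bad in wqo q′ bad′

join-odd : ∀ p q x → join p q (suc (x + x)) ≡ q x
join-odd p q zero    = refl
join-odd p q (suc x) rewrite +-suc x x = join-odd (λ k → p (suc k)) (λ k → q (suc k)) x

rightHalfCode : Code 1
rightHalfCode = compose₁ orc (compose₁ succ (compose₂ addCode (proj (# 0)) (proj (# 0))))

rightHalfCode-implements : ∀ p q → Implements (join p q) rightHalfCode (q $ⁿ_)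
rightHalfCode-implements p q = Implements-ext
  (compose₁-implements orc-implements
    (compose₁-implements succ-implements
      (compose₂-implements addCode-implements (proj-implements (# 0)) (proj-implements (# 0)))))
  (λ { (y ∷ []) → join-odd p q y })

proposition2p2 : BS ≡W BS-PO
proposition2p2 = BS≤BS-PO , BS-PO≤BS
  where
  BS≤BS-PO : BS ≤W BS-PO
  BS≤BS-PO = restrictCode , rightHalfCode , λ R (qo , ¬wqo) →
    restrict R , Implements⇒Computes restrictCode-implements ,
    (restrict-isPartialOrder qo , restrict-¬wqo qo ¬wqo) ,
    λ q bad → q , Implements⇒Computes (rightHalfCode-implements R q) , restrict-bad⇒bad {R} q bad

  BS-PO≤BS : BS-PO ≤W BS
  BS-PO≤BS = orc , rightHalfCode , λ R (po , ¬wqo) →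
    R , Implements⇒Computes orc-implements , (IsPartialOrder.isQuasiOrder po , ¬wqo) ,
    λ q bad → q , Implements⇒Computes (rightHalfCode-implements R q) , bad
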